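{- Let $R=(V,A)$ be a digraph with $n=|V|$ vertices and $cc$ (weakly) connected components, let $f$ be the size of a minimum directed feedback vertex set of $R$, and let $k$ be a nonnegative integer. Then there exists a temporal digraph $\mathcal G=(V,\mathcal E)$ with at most $k$ temporal arcs such that for every arc $(u,v)\in A$ there is a journey from $u$ to $v$ in $\mathcal G$ if and only if $k\geq n+f-cc$.
   Context: A temporal digraph is a pair $\mathcal G=(V,\mathcal E)$ where $V$ is a finite vertex set and $\mathcal E$ is a finite set of (distinct) temporal arcs, a temporal arc being a pair $((u,v),t)$ with $u\neq v\in V$ and $t$ a positive integer (its appearance time). A journey from $u_0$ to $u_k$ is a sequence $(u_0,u_1,t_0),(u_1,u_2,t_1),\dots,(u_{k-1},u_k,t_{k-1})$ such that each $((u_i,u_{i+1}),t_i)\in\mathcal E$ and $t_0<t_1<\dots<t_{k-1}$ (strictly increasing times). A directed feedback vertex set (DFVS) of a digraph is a vertex set $S$ such that every circuit (directed cycle) of the digraph contains a vertex of $S$. Connected components of a digraph are those of its underlying undirected graph. -}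

module Defs where

open import Data.Nat using (ℕ; suc; _≤_; _<_)
open import Data.Fin using (Fin)
open import Data.Fin.Subset using (Subset; _∈_)
open import Data.Bool using (Bool; true; false; T)
open import Data.List using (List; []; _∷_)
open import Data.List.Relation.Unary.Any using (Any)
open import Data.List.Relation.Unary.Unique.Propositional using (Unique)
open import Data.Product using (_×_; ∃; _,_)
open import Relation.Nullary using (¬_)
open import Data.List.Relation.Unary.All using (All)
open import Relation.Binary.PropositionalEquality using (_≡_)
open import Relation.Binary.Construct.Closure.ReflexiveTransitive using (Star)
open import Data.Sum using (_⊎_)
open import Function.Bundles using (_⇔_)
import Data.List.Membership.Propositional as LM
open import Data.Fin.Subset using (∣_∣)

Digraph : ℕ → Set
Digraph n = Fin n → Fin n → Bool

Loopless : ∀ {n} → Digraph n → Set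
Loopless {n} A = (u : Fin n) → A u u ≡ false

Arcs : ∀ {n} → Digraph n → Fin n → List (Fin n) → Fin n → Set
Arcs A u []       w = T (A u w)
Arcs A u (x ∷ xs) w = T (A u x) × Arcs A x xs w

IsCircuit : ∀ {n} → Digraph n → Fin n → List (Fin n) → Set
IsCircuit A x xs = Unique (x ∷ xs) × Arcs A x xs x

IsDFVS : ∀ {n} → Digraph n → Subset n → Set
IsDFVS {n} A S = (x : Fin n) (xs : List (Fin n)) → IsCircuit A x xs →
                 Any (λ v → v ∈ S) (x ∷ xs)

MinDFVSSize : ∀ {n} → Digraph n → ℕ → Set
MinDFVSSize {n} A f =
  (∃ λ S → IsDFVS A S × ∣ S ∣ ≡ f) × ((S : Subset n) → IsDFVS A S → f ≤ ∣ S ∣)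

UAdj : ∀ {n} → Digraph n → Fin n → Fin n → Set
UAdj A u v = T (A u v) ⊎ T (A v u)

WeaklyConnected : ∀ {n} → Digraph n → Fin n → Fin n → Set
WeaklyConnected A = Star (UAdj A)

-- R has exactly cc (weakly) connected components: there is a surjective
-- labelling of the vertices by Fin cc whose fibres are exactly the
-- weak components.
NumComponents : ∀ {n} → Digraph n → ℕ → Set
NumComponents {n} A cc =
  ∃ λ (comp : Fin n → Fin cc) →
    ((c : Fin cc) → ∃ λ u → comp u ≡ c) ×
    ((u v : Fin n) → (comp u ≡ comp v) ⇔ WeaklyConnected A u v)

TArc : ℕ → Set
TArc n = Fin n × Fin n × ℕ

ValidTArc : ∀ {n} → TArc n → Set
ValidTArc (u , v , t) = ¬ (u ≡ v) × 1 ≤ t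

record TemporalDigraph (n : ℕ) : Set where
  field
    arcs     : List (TArc n)
    distinct : Unique arcs
    valid    : All ValidTArc arcs

open TemporalDigraph public

-- JourneyAt 𝒢 u v t : a journey from u to v in 𝒢 whose first temporal
-- arc has time t; times strictly increase along the journey.
data JourneyAt {n} (𝒢 : TemporalDigraph n) : Fin n → Fin n → ℕ → Set where
  last : ∀ {u v t} → (u , v , t) LM.∈ arcs 𝒢 → JourneyAt 𝒢 u v t
  step : ∀ {u w v t t'} → (u , w , t) LM.∈ arcs 𝒢 → t < t' →
         JourneyAt 𝒢 w v t' → JourneyAt 𝒢 u v t

Journey : ∀ {n} → TemporalDigraph n → Fin n → Fin n → Set
Journey 𝒢 u v = ∃ λ t → JourneyAt 𝒢 u v t

{-# OPTIONS --safe #-}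
module Submission where

-- Add the temporal arcs one by one in decreasing order of time, maintaining
-- a surjective labelling of the vertices respected by the arcs added so far, a set X of
-- exceptional vertices, and a rank strictly increasing along every journey with both ends
-- outside X, subject to |X| + n ≤ #arcs + #labels.  The new arc (x, y, t) is the
-- earliest one, so a journey can only use it as its first arc.  If x and y carry the same
-- label, put x into X; otherwise identify the two labels and lift the ranks of y's label
-- above the rank of x.  Once all arcs are in, each arc of R is realised by a journey, so
-- the rank increases along the arcs of R outside X: X is a DFVS, hence |X| ≥ f, and the
-- labels are constant on the components of R, hence #labels ≤ cc.
--
-- Fix a minimum DFVS S.  By minimality and looplessness every component of
-- R has a vertex outside S.  Sort R − S topologically; in every component join the
-- consecutive vertices of its chain by arcs at times 2, 3, …, and give each s ∈ S an arc
-- at time 1 to the first vertex of the chain of its component and an arc at time n + 2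
-- from the last one.  That makes 2f + (n − f − cc) arcs.

open import Defs
open import Data.Nat using (ℕ; zero; suc; _+_; _∸_; _≤_; _<_; z≤n; s≤s) renaming (_≟_ to _≟ⁿ_)
open import Data.Nat.Properties
open import Data.Fin using (Fin; punchOut; punchIn) renaming (_≟_ to _≟ᶠ_)
open import Data.Fin.Properties
  using (any?; punchOut-cong; punchOut-punchIn; punchInᵢ≢i; injective⇒≤; ¬Fin0)
open import Data.Fin.Subset using (Subset; inside; outside; ∣_∣; _∪_; ⁅_⁆; _-_; ⊤; ⊥; ∁)
  renaming (_∈_ to _∈ₛ_; _∉_ to _∉ₛ_)
open import Data.Fin.Subset.Properties
  using ( _∈?_; ∈⊤; ∣⊤∣≡n; ∣⊥∣≡0; ∣⁅x⁆∣≡1; x∈⁅x⁆; x∈p∪q⁺; x∈p∧x≢y⇒x∈p-y; x∈p⇒∣p-x∣<∣p∣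
        ; x∉p⇒x∈∁p; x∈∁p⇒x∉p)
open import Data.Vec using (_∷_; [])
open import Data.Bool using (T)
open import Data.Bool.Properties using (T?)
open import Data.Maybe using (fromMaybe)
open import Data.List
  using (List; []; _∷_; length; filter; take; head; allFin; map; concat; concatMap; _++_; deduplicate)
import Data.List as List
open import Data.List.Properties
  using (filter-notAll; length-++; length-map; length-tabulate; length-deduplicate)
open import Data.List.Membership.Propositional using (_∈_; find; lose)
open import Data.List.Membership.Propositional.Properties
  using (∈-filter⁺; ∈-filter⁻; ∈-allFin; ∈-map⁺; ∈-++⁺ˡ; ∈-++⁺ʳ; ∈-concat⁺′; ∈-deduplicate⁺)
open import Data.List.Relation.Binary.Subset.Propositional using (_⊆_)
open import Data.List.Relation.Binary.Disjoint.Propositional using (Disjoint)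
open import Data.List.Relation.Binary.Permutation.Propositional using (↭-sym)
open import Data.List.Relation.Binary.Permutation.Propositional.Properties using (∈-resp-↭; ↭-length)
open import Data.List.Relation.Unary.Any as Any using (Any; here; there)
open import Data.List.Relation.Unary.All as All using (All; []; _∷_)
import Data.List.Relation.Unary.All.Properties as All
open import Data.List.Relation.Unary.All.Properties using (¬Any⇒All¬; All¬⇒¬Any)
open import Data.List.Relation.Unary.AllPairs as AllPairs using (AllPairs; []; _∷_)
import Data.List.Relation.Unary.AllPairs.Properties as AllPairs
open import Data.List.Relation.Unary.Linked using (Linked; []; [-]; _∷_)
open import Data.List.Relation.Unary.Linked.Properties using (Linked⇒AllPairs)
open import Data.List.Relation.Unary.Unique.Propositional using (Unique)
import Data.List.Relation.Unary.Unique.Propositional.Properties as Unique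
open import Data.List.Relation.Unary.Unique.DecPropositional.Properties using (deduplicate-!)
import Data.List.Sort
open import Data.Product using (_×_; _,_; ∃; ∃₂; proj₁; proj₂)
open import Data.Product.Properties using (≡-dec)
open import Data.Sum using (_⊎_; inj₁; inj₂)
open import Data.Empty using (⊥-elim)
open import Function using (_∘_)
open import Function.Bundles using (_⇔_; mk⇔; Equivalence)
open import Relation.Nullary using (¬_; Dec; yes; no; contradiction; ¬?; _×-dec_)
open import Relation.Unary using (Pred; Decidable)
open import Relation.Binary.PropositionalEquality
  using (_≡_; _≢_; refl; sym; trans; cong; cong₂; subst)
open import Relation.Binary.Construct.Closure.ReflexiveTransitive using (ε; _◅_)
import Relation.Binary.Construct.On as On

data Before {A : Set} : List A → A → A → Set where
  here  : ∀ {u v xs} → v ∈ xs → Before (u ∷ xs) u v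
  there : ∀ {x u v xs} → Before xs u v → Before (x ∷ xs) u v

module _ {A : Set} {p} {P : Pred A p} (P? : Decidable P) where

  Before-filter : ∀ {xs u v} → Before xs u v → P u → P v → Before (filter P? xs) u v
  Before-filter {u = u} (here v∈xs) Pu Pv with P? u
  ... | yes _  = here (∈-filter⁺ P? v∈xs Pv)
  ... | no ¬Pu = contradiction Pu ¬Pu
  Before-filter {x ∷ _} (there b) Pu Pv with P? x
  ... | yes _ = there (Before-filter b Pu Pv)
  ... | no  _ = Before-filter b Pu Pv

module _ {A : Set} (d : A) where

  head-∈ : ∀ {x xs} → x ∈ xs → fromMaybe d (head xs) ∈ xs
  head-∈ (here _)  = here refl
  head-∈ (there _) = here refl

  head-Before : ∀ {x xs} → x ∈ xs → fromMaybe d (head xs) ≡ x ⊎ Before xs (fromMaybe d (head xs)) x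
  head-Before (here refl)  = inj₁ refl
  head-Before (there x∈xs) = inj₂ (here x∈xs)

  last-∈ : ∀ {x xs} → x ∈ xs → fromMaybe d (List.last xs) ∈ xs
  last-∈ {xs = y ∷ []}     _ = here refl
  last-∈ {xs = y ∷ z ∷ zs} _ = there (last-∈ {xs = z ∷ zs} (here refl))

  last-Before : ∀ {x xs} → x ∈ xs →
                x ≡ fromMaybe d (List.last xs) ⊎ Before xs x (fromMaybe d (List.last xs))
  last-Before {xs = y ∷ []}     (here refl) = inj₁ refl
  last-Before {xs = y ∷ z ∷ zs} (here refl) = inj₂ (here (last-∈ {xs = z ∷ zs} (here refl)))
  last-Before {xs = y ∷ z ∷ zs} (there x∈) with last-Before x∈
  ... | inj₁ x≡last = inj₁ x≡last
  ... | inj₂ b      = inj₂ (there b)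

length≤∣_∣ : ∀ {n} (p : Subset n) {xs : List (Fin n)} → Unique xs → All (_∈ₛ p) xs → length xs ≤ ∣ p ∣
length≤∣ p ∣ []                []                 = z≤n
length≤∣ p ∣ {x ∷ xs} (x∉xs ∷ !xs) (x∈p ∷ xs⊆p) = begin
  suc (length xs) ≤⟨ s≤s (length≤∣ p - x ∣ !xs (All.zipWith in-p-x (x∉xs , xs⊆p))) ⟩
  suc ∣ p - x ∣   ≤⟨ x∈p⇒∣p-x∣<∣p∣ x∈p ⟩
  ∣ p ∣           ∎
  where
  open ≤-Reasoning
  in-p-x : ∀ {y} → x ≢ y × y ∈ₛ p → y ∈ₛ p - x
  in-p-x (x≢y , y∈p) = x∈p∧x≢y⇒x∈p-y y∈p (x≢y ∘ sym)

length≤n : ∀ {n} {xs : List (Fin n)} → Unique xs → length xs ≤ n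
length≤n {n} {xs} !xs = subst (length xs ≤_) (∣⊤∣≡n n) (length≤∣ ⊤ ∣ !xs (All.tabulate (λ _ → ∈⊤)))

∣p∪q∣≤∣p∣+∣q∣ : ∀ {n} (p q : Subset n) → ∣ p ∪ q ∣ ≤ ∣ p ∣ + ∣ q ∣
∣p∪q∣≤∣p∣+∣q∣ []            []            = z≤n
∣p∪q∣≤∣p∣+∣q∣ (inside  ∷ p) (inside  ∷ q) =
  s≤s (≤-trans (∣p∪q∣≤∣p∣+∣q∣ p q) (+-monoʳ-≤ ∣ p ∣ (n≤1+n ∣ q ∣)))
∣p∪q∣≤∣p∣+∣q∣ (inside  ∷ p) (outside ∷ q) = s≤s (∣p∪q∣≤∣p∣+∣q∣ p q)
∣p∪q∣≤∣p∣+∣q∣ (outside ∷ p) (inside  ∷ q) =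
  subst (suc ∣ p ∪ q ∣ ≤_) (sym (+-suc ∣ p ∣ ∣ q ∣)) (s≤s (∣p∪q∣≤∣p∣+∣q∣ p q))
∣p∪q∣≤∣p∣+∣q∣ (outside ∷ p) (outside ∷ q) = ∣p∪q∣≤∣p∣+∣q∣ p q

elements : ∀ {n} → Subset n → List (Fin n)
elements {n} p = filter (_∈? p) (allFin n)

module _ {n} {p : Subset n} where

  elements-unique : Unique (elements p)
  elements-unique = Unique.filter⁺ (_∈? p) (Unique.allFin⁺ n)

  ∈-elements⁺ : ∀ {v} → v ∈ₛ p → v ∈ elements p
  ∈-elements⁺ {v} = ∈-filter⁺ (_∈? p) (∈-allFin v)

  ∈-elements⁻ : ∀ {v} → v ∈ elements p → v ∈ₛ p
  ∈-elements⁻ = proj₂ ∘ ∈-filter⁻ (_∈? p) {xs = allFin n}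

∈-elements-∁⁺ : ∀ {n} {p : Subset n} {v} → v ∉ₛ p → v ∈ elements (∁ p)
∈-elements-∁⁺ = ∈-elements⁺ ∘ x∉p⇒x∈∁p

∈-elements-∁⁻ : ∀ {n} {p : Subset n} {v} → v ∈ elements (∁ p) → v ∉ₛ p
∈-elements-∁⁻ = x∈∁p⇒x∉p ∘ ∈-elements⁻

module _ {n} (A : Digraph n) (S : Subset n) (rank : Fin n → ℕ)
         (increasing : ∀ {u v} → T (A u v) → u ∉ₛ S → v ∉ₛ S → rank u < rank v) where

  rank-increases-along : ∀ {u xs w} → Arcs A u xs w → All (_∉ₛ S) (u ∷ xs) → w ∉ₛ S → rank u < rank w
  rank-increases-along {xs = []}    u→w        (u∉S ∷ [])         w∉S = increasing u→w u∉S w∉S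
  rank-increases-along {xs = x ∷ _} (u→x , as) (u∉S ∷ x∉S ∷ xs∉S) w∉S =
    <-trans (increasing u→x u∉S x∉S) (rank-increases-along as (x∉S ∷ xs∉S) w∉S)

  increasing-rank⇒DFVS : IsDFVS A S
  increasing-rank⇒DFVS x xs (_ , arcs) with Any.any? (_∈? S) (x ∷ xs)
  ... | yes hit  = hit
  ... | no  miss = ⊥-elim (<-irrefl refl (rank-increases-along arcs avoid (All.head avoid)))
    where avoid = ¬Any⇒All¬ (x ∷ xs) miss

WeaklyConnected⇒≡ : ∀ {n} {B : Set} {A : Digraph n} (g : Fin n → B) →
                    (∀ {u v} → T (A u v) → g u ≡ g v) →
                    ∀ {u v} → WeaklyConnected A u v → g u ≡ g v
WeaklyConnected⇒≡ g g-resp ε                = refl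
WeaklyConnected⇒≡ g g-resp (inj₁ u→w ◅ w~v) = trans (g-resp u→w) (WeaklyConnected⇒≡ g g-resp w~v)
WeaklyConnected⇒≡ g g-resp (inj₂ w→u ◅ w~v) = trans (sym (g-resp w→u)) (WeaklyConnected⇒≡ g g-resp w~v)

Arcs⇒WeaklyConnected : ∀ {n} {A : Digraph n} {u xs w z} → Arcs A u xs w → z ∈ xs → WeaklyConnected A u z
Arcs⇒WeaklyConnected (u→x , _)  (here refl) = inj₁ u→x ◅ ε
Arcs⇒WeaklyConnected (u→x , as) (there z∈)  = inj₁ u→x ◅ Arcs⇒WeaklyConnected as z∈

IsMinimumDFVS : ∀ {n} → Digraph n → Subset n → Set
IsMinimumDFVS {n} A S = IsDFVS A S × ((S′ : Subset n) → IsDFVS A S′ → ∣ S ∣ ≤ ∣ S′ ∣)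

module _ {n c} {A : Digraph n} (label : Fin n → Fin c)
         (label-resp : ∀ {u v} → T (A u v) → label u ≡ label v) where

  Arcs-within-class : ∀ {x xs w y} → Arcs A x xs w → y ∈ x ∷ xs → label y ≡ label x
  Arcs-within-class _    (here refl) = refl
  Arcs-within-class arcs (there y∈)  =
    sym (WeaklyConnected⇒≡ label label-resp (Arcs⇒WeaklyConnected arcs y∈))

  every-class-meets-complement : Loopless A → ∀ {S} → IsMinimumDFVS A S →
                                 ∀ u → ∃ λ w → w ∉ₛ S × label w ≡ label u
  every-class-meets-complement loopless {S} minimum u
    with any? (λ w → ¬? (w ∈? S) ×-dec (label w ≟ᶠ label u))
  ... | yes found = found
  ... | no  none  = ⊥-elim (<⇒≱ (x∈p⇒∣p-x∣<∣p∣ (class⊆S refl)) (proj₂ minimum (S - u) S-u-DFVS))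
    where
    class⊆S : ∀ {w} → label w ≡ label u → w ∈ₛ S
    class⊆S {w} w~u with w ∈? S
    ... | yes w∈S = w∈S
    ... | no  w∉S = contradiction (w , w∉S , w~u) none

    -- A circuit through u lies in u's class, hence in S, and (R being loopless) has a
    -- vertex other than u.
    S-u-DFVS : IsDFVS A (S - u)
    S-u-DFVS x []       (_ , x→x) = ⊥-elim (subst T (loopless x) x→x)
    S-u-DFVS x (y ∷ ys) circuit@(((x≢y ∷ _) ∷ _) , arcs) with find (proj₁ minimum x (y ∷ ys) circuit)
    ... | z , z∈ , z∈S with z ≟ᶠ u
    ...   | no z≢u = lose z∈ (x∈p∧x≢y⇒x∈p-y z∈S z≢u)
    ...   | yes refl with x ≟ᶠ u
    ...     | no x≢u   = here (x∈p∧x≢y⇒x∈p-y (class⊆S (sym (Arcs-within-class arcs z∈))) x≢u)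
    ...     | yes refl = there (here (x∈p∧x≢y⇒x∈p-y y∈S (x≢y ∘ sym)))
      where y∈S = class⊆S (Arcs-within-class {xs = y ∷ ys} arcs (there (here refl)))

CircuitWithin : ∀ {n} → Digraph n → List (Fin n) → Set
CircuitWithin A ps = ∃₂ λ x xs → IsCircuit A x xs × All (_∈ ps) (x ∷ xs)

AcyclicOn : ∀ {n} → Digraph n → List (Fin n) → Set
AcyclicOn A ps = ¬ CircuitWithin A ps

complement-acyclic : ∀ {n} {A : Digraph n} {S} → IsDFVS A S → AcyclicOn A (elements (∁ S))
complement-acyclic dfvs (x , xs , circuit , in-complement) =
  All¬⇒¬Any (All.map ∈-elements-∁⁻ in-complement) (dfvs x xs circuit)

module _ {n} (A : Digraph n) where
  open import Data.List.Membership.DecPropositional (_≟ᶠ_ {n}) using () renaming (_∈?_ to _∈ᴸ?_)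

  Path : List (Fin n) → Set
  Path = Linked (λ u v → T (A u v))

  close-path : ∀ {h t p z} → Path (h ∷ t) → p ∈ h ∷ t → T (A p z) → ∃ λ i → Arcs A h (take i t) z
  close-path _            (here refl) p→z = 0 , p→z
  close-path (h→x ∷ path) (there p∈)  p→z with close-path path p∈ p→z
  ... | i , arcs = suc i , h→x , arcs
  close-path [-]          (there ())  _

  -- Extend the path h ∷ t backwards by predecessors until it closes up into a circuit;
  -- being duplicate-free, it cannot grow beyond n vertices.
  walk-back : ∀ {ps} → (∀ {v} → v ∈ ps → ∃ λ u → u ∈ ps × T (A u v)) →
              ∀ m {h t} → length t + m ≡ n → Path (h ∷ t) → Unique (h ∷ t) → All (_∈ ps) (h ∷ t) →
              CircuitWithin A ps
  walk-back pred zero {t = t} len _ !path _ =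
    ⊥-elim (1+n≰n (subst (λ k → suc k ≤ n) (trans (sym (+-identityʳ (length t))) len) (length≤n !path)))
  walk-back pred (suc m) {h} {t} len path !path (h∈ ∷ t∈) with pred h∈
  ... | p , p∈ , p→h with p ∈ᴸ? h ∷ t
  ...   | yes p∈path = let i , arcs = close-path path p∈path p→h in
                       h , take i t , (Unique.take⁺ (suc i) !path , arcs) , All.take⁺ (suc i) (h∈ ∷ t∈)
  ...   | no  p∉path = walk-back pred m (trans (sym (+-suc (length t) m)) len)
                         (p→h ∷ path) (¬Any⇒All¬ _ p∉path ∷ !path) (p∈ ∷ h∈ ∷ t∈)

  source : ∀ {ps x} → AcyclicOn A ps → x ∈ ps → ∃ λ s → s ∈ ps × (∀ {u} → u ∈ ps → ¬ T (A u s))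
  source {ps} {x} acyclic x∈ with Any.any? (λ s → ¬? (Any.any? (λ u → T? (A u s)) ps)) ps
  ... | yes found  = let s , s∈ , no-pred = find found in s , s∈ , λ u∈ u→s → no-pred (lose u∈ u→s)
  ... | no  absent = ⊥-elim (acyclic (walk-back pred n refl [-] ([] ∷ []) (x∈ ∷ [])))
    where
    pred : ∀ {v} → v ∈ ps → ∃ λ u → u ∈ ps × T (A u v)
    pred {v} v∈ with Any.any? (λ u → T? (A u v)) ps
    ... | yes has   = find has
    ... | no  lacks = contradiction (lose v∈ lacks) absent

record TopologicalOrder {n} (A : Digraph n) (ps : List (Fin n)) : Set where
  field
    order   : List (Fin n)
    unique  : Unique order
    members : ∀ {v} → v ∈ order ⇔ v ∈ ps
    forward : ∀ {u v} → T (A u v) → u ∈ ps → v ∈ ps → Before order u v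

module _ {n} (A : Digraph n) where

  topological-sort : ∀ m ps → length ps ≤ m → AcyclicOn A ps → TopologicalOrder A ps
  topological-sort _ [] _ _ = record
    { order = [] ; unique = [] ; members = mk⇔ (λ ()) (λ ()) ; forward = λ _ () }
  topological-sort (suc m) ps@(_ ∷ _) len acyclic with source A acyclic (here refl)
  ... | s , s∈ps , s-source = record
    { order   = s ∷ order
    ; unique  = All.tabulate (λ v∈ s≡v → proj₂ (in-rest v∈) (sym s≡v)) ∷ unique
    ; members = mk⇔ (λ { (here refl) → s∈ps ; (there v∈) → proj₁ (in-rest v∈) }) add-source
    ; forward = forward′
    }
    where
    ≢s? = λ v → ¬? (v ≟ᶠ s)
    rest = filter ≢s? ps

    rest-shorter : length rest < length ps
    rest-shorter = filter-notAll ≢s? ps (lose s∈ps (λ s≢s → s≢s refl))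

    open TopologicalOrder (topological-sort m rest (≤-pred (≤-trans rest-shorter len))
      (λ (y , ys , circuit , in-rest) → acyclic (y , ys , circuit , All.map (proj₁ ∘ ∈-filter⁻ ≢s?) in-rest)))

    in-rest : ∀ {v} → v ∈ order → v ∈ ps × v ≢ s
    in-rest = ∈-filter⁻ ≢s? {xs = ps} ∘ Equivalence.to members

    in-order : ∀ {v} → v ∈ ps → v ≢ s → v ∈ order
    in-order v∈ v≢s = Equivalence.from members (∈-filter⁺ ≢s? v∈ v≢s)

    add-source : ∀ {v} → v ∈ ps → v ∈ s ∷ order
    add-source {v} v∈ with v ≟ᶠ s
    ... | yes refl = here refl
    ... | no  v≢s  = there (in-order v∈ v≢s)

    forward′ : ∀ {u v} → T (A u v) → u ∈ ps → v ∈ ps → Before (s ∷ order) u v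
    forward′ {u} {v} u→v u∈ v∈ with v ≟ᶠ s | u ≟ᶠ s
    ... | yes refl | _        = ⊥-elim (s-source u∈ u→v)
    ... | no  v≢s  | yes refl = here (in-order v∈ v≢s)
    ... | no  v≢s  | no  u≢s  = there (forward u→v (∈-filter⁺ ≢s? u∈ u≢s) (∈-filter⁺ ≢s? v∈ v≢s))

time : ∀ {n} → TArc n → ℕ
time (_ , _ , t) = t

data JourneyIn {n} (L : List (TArc n)) : Fin n → Fin n → ℕ → ℕ → Set where
  arc    : ∀ {u v t} → (u , v , t) ∈ L → JourneyIn L u v t t
  _∷⟨_⟩_ : ∀ {u w v t t′ t″} → (u , w , t) ∈ L → t < t′ → JourneyIn L w v t′ t″ → JourneyIn L u v t t″

module _ {n} {L : List (TArc n)} where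

  _++⟨_⟩_ : ∀ {u w v t₀ t₁ t₂ t₃} → JourneyIn L u w t₀ t₁ → t₁ < t₂ → JourneyIn L w v t₂ t₃ →
            JourneyIn L u v t₀ t₃
  arc e          ++⟨ lt ⟩ k = e ∷⟨ lt ⟩ k
  (e ∷⟨ lt′ ⟩ j) ++⟨ lt ⟩ k = e ∷⟨ lt′ ⟩ (j ++⟨ lt ⟩ k)

  departure-∈ : ∀ {u v t t′} → JourneyIn L u v t t′ → ∃ λ w → (u , w , t) ∈ L
  departure-∈ (arc e)      = _ , e
  departure-∈ (e ∷⟨ _ ⟩ _) = _ , e

  arrival-∈ : ∀ {u v t t′} → JourneyIn L u v t t′ → ∃ λ w → (w , v , t′) ∈ L
  arrival-∈ (arc e)      = _ , e
  arrival-∈ (_ ∷⟨ _ ⟩ j) = arrival-∈ j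

  JourneyIn-mono : ∀ {L′ u v t t′} → L ⊆ L′ → JourneyIn L u v t t′ → JourneyIn L′ u v t t′
  JourneyIn-mono L⊆L′ (arc e)       = arc (L⊆L′ e)
  JourneyIn-mono L⊆L′ (e ∷⟨ lt ⟩ j) = L⊆L′ e ∷⟨ lt ⟩ JourneyIn-mono L⊆L′ j

module _ {n} {𝒢 : TemporalDigraph n} where

  JourneyAt⇒JourneyIn : ∀ {u v t} → JourneyAt 𝒢 u v t → ∃ (JourneyIn (arcs 𝒢) u v t)
  JourneyAt⇒JourneyIn (last e)      = _ , arc e
  JourneyAt⇒JourneyIn (step e lt j) = _ , e ∷⟨ lt ⟩ proj₂ (JourneyAt⇒JourneyIn j)

  JourneyIn⇒JourneyAt : ∀ {u v t t′} → JourneyIn (arcs 𝒢) u v t t′ → JourneyAt 𝒢 u v t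
  JourneyIn⇒JourneyAt (arc e)       = last e
  JourneyIn⇒JourneyAt (e ∷⟨ lt ⟩ j) = step e lt (JourneyIn⇒JourneyAt j)

Realizes : ∀ {n} → TemporalDigraph n → Digraph n → Set
Realizes {n} 𝒢 A = (u v : Fin n) → T (A u v) → Journey 𝒢 u v

module _ {n} {x y : Fin n} {t : ℕ} {rest : List (TArc n)} where

  avoids-earlier : ∀ {u v t₀ t₁} → t < t₀ → JourneyIn ((x , y , t) ∷ rest) u v t₀ t₁ →
                   JourneyIn rest u v t₀ t₁
  avoids-earlier t<t₀ (arc (here refl))      = contradiction t<t₀ (<-irrefl refl)
  avoids-earlier t<t₀ (arc (there e))        = arc e
  avoids-earlier t<t₀ (here refl ∷⟨ _ ⟩ _)   = contradiction t<t₀ (<-irrefl refl)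
  avoids-earlier t<t₀ (there e ∷⟨ lt ⟩ j)    = e ∷⟨ lt ⟩ avoids-earlier (<-trans t<t₀ lt) j

  journey-split : All (λ a → t ≤ time a) rest →
                  ∀ {u v t₀ t₁} → JourneyIn ((x , y , t) ∷ rest) u v t₀ t₁ →
                  JourneyIn rest u v t₀ t₁ ⊎ (u ≡ x × (v ≡ y ⊎ ∃₂ (JourneyIn rest y v)))
  journey-split _     (arc (here refl))     = inj₂ (refl , inj₁ refl)
  journey-split _     (arc (there e))       = inj₁ (arc e)
  journey-split _     (here refl ∷⟨ lt ⟩ j) = inj₂ (refl , inj₂ (_ , _ , avoids-earlier lt j))
  journey-split later (there e ∷⟨ lt ⟩ j)   =
    inj₁ (e ∷⟨ lt ⟩ avoids-earlier (≤-<-trans (All.lookup later e) lt) j)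

identify : ∀ {c} (i j : Fin (suc c)) → i ≢ j → Fin (suc c) → Fin c
identify i j i≢j k with k ≟ᶠ j
... | yes _   = punchOut (i≢j ∘ sym)
... | no  k≢j = punchOut (k≢j ∘ sym)

module _ {c} (i j : Fin (suc c)) (i≢j : i ≢ j) where

  identify-identifies : identify i j i≢j i ≡ identify i j i≢j j
  identify-identifies with i ≟ᶠ j | j ≟ᶠ j
  ... | yes i≡j | _       = contradiction i≡j i≢j
  ... | no  _   | yes _   = punchOut-cong j refl
  ... | no  _   | no  j≢j = contradiction refl j≢j

  identify-surjective : ∀ d → ∃ λ k → identify i j i≢j k ≡ d
  identify-surjective d = punchIn j d , identify-punchIn
    where
    identify-punchIn : identify i j i≢j (punchIn j d) ≡ d
    identify-punchIn with punchIn j d ≟ᶠ j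
    ... | yes j≡j = contradiction j≡j (punchInᵢ≢i j d)
    ... | no  _   = trans (punchOut-cong j refl) (punchOut-punchIn j)

module Raise {n c} (label : Fin n → Fin c) (rank : Fin n → ℕ) (x : Fin n) (j : Fin c) where

  raise : ∀ v → Dec (label v ≡ j) → ℕ
  raise v (yes _) = suc (rank x) + rank v
  raise v (no  _) = rank v

  raised : Fin n → ℕ
  raised v = raise v (label v ≟ᶠ j)

  raised-outside : ∀ {v} → label v ≢ j → raised v ≡ rank v
  raised-outside {v} v≁j with label v ≟ᶠ j
  ... | yes v~j = contradiction v~j v≁j
  ... | no  _   = refl

  raised-above : ∀ {v} → label v ≡ j → rank x < raised v
  raised-above {v} v~j with label v ≟ᶠ j
  ... | yes _   = s≤s (m≤m+n (rank x) (rank v))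
  ... | no  v≁j = contradiction v~j v≁j

  raised-mono : ∀ {u v} → label u ≡ label v → rank u < rank v → raised u < raised v
  raised-mono {u} {v} u~v lt with label u ≟ᶠ j | label v ≟ᶠ j
  ... | yes _   | yes _   = +-monoʳ-< (suc (rank x)) lt
  ... | no  _   | no  _   = lt
  ... | yes u~j | no  v≁j = contradiction (trans (sym u~v) u~j) v≁j
  ... | no  u≁j | yes v~j = contradiction (trans u~v v~j) u≁j

record Ranking {n} (L : List (TArc n)) (classes : ℕ) : Set where
  field
    label            : Fin n → Fin classes
    label-surjective : ∀ d → ∃ λ u → label u ≡ d
    label-respects   : ∀ {u v t} → (u , v , t) ∈ L → label u ≡ label v
    exceptions       : Subset n
    rank             : Fin n → ℕ
    rank-increases   : ∀ {u v t t′} → JourneyIn L u v t t′ →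
                       u ∉ₛ exceptions → v ∉ₛ exceptions → rank u < rank v
    size             : ∣ exceptions ∣ + n ≤ length L + classes

  label-respects-journeys : ∀ {u v t t′} → JourneyIn L u v t t′ → label u ≡ label v
  label-respects-journeys (arc e)      = label-respects e
  label-respects-journeys (e ∷⟨ _ ⟩ j) = trans (label-respects e) (label-respects-journeys j)

ranking-[] : ∀ {n} → Ranking {n} [] n
ranking-[] {n} = record
  { label            = λ u → u
  ; label-surjective = λ d → d , refl
  ; label-respects   = λ ()
  ; exceptions       = ⊥
  ; rank             = λ _ → 0
  ; rank-increases   = λ { (arc ()) ; (() ∷⟨ _ ⟩ _) }
  ; size             = ≤-reflexive (cong (_+ n) (∣⊥∣≡0 n))
  }

module _ {n} {x y : Fin n} {t : ℕ} {rest : List (TArc n)} (later : All (λ a → t ≤ time a) rest) where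

  absorb : ∀ {c} (ρ : Ranking rest c) → Ranking.label ρ x ≡ Ranking.label ρ y →
           Ranking ((x , y , t) ∷ rest) c
  absorb {c} ρ x~y = record
    { label            = label
    ; label-surjective = label-surjective
    ; label-respects   = λ { (here refl) → x~y ; (there e) → label-respects e }
    ; exceptions       = exceptions ∪ ⁅ x ⁆
    ; rank             = rank
    ; rank-increases   = increases
    ; size             = begin
        ∣ exceptions ∪ ⁅ x ⁆ ∣ + n      ≤⟨ +-monoˡ-≤ n (∣p∪q∣≤∣p∣+∣q∣ exceptions ⁅ x ⁆) ⟩
        ∣ exceptions ∣ + ∣ ⁅ x ⁆ ∣ + n  ≡⟨ cong (λ k → ∣ exceptions ∣ + k + n) (∣⁅x⁆∣≡1 x) ⟩
        ∣ exceptions ∣ + 1 + n          ≡⟨ cong (_+ n) (+-comm ∣ exceptions ∣ 1) ⟩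
        suc (∣ exceptions ∣ + n)        ≤⟨ s≤s size ⟩
        suc (length rest + c)           ∎
    }
    where
    open Ranking ρ
    open ≤-Reasoning

    increases : ∀ {u v t₀ t₁} → JourneyIn ((x , y , t) ∷ rest) u v t₀ t₁ →
                u ∉ₛ exceptions ∪ ⁅ x ⁆ → v ∉ₛ exceptions ∪ ⁅ x ⁆ → rank u < rank v
    increases j u∉ v∉ with journey-split later j
    ... | inj₁ j′         = rank-increases j′ (u∉ ∘ x∈p∪q⁺ ∘ inj₁) (v∉ ∘ x∈p∪q⁺ ∘ inj₁)
    ... | inj₂ (refl , _) = contradiction (x∈p∪q⁺ (inj₂ (x∈⁅x⁆ x))) u∉

  merge : ∀ {c} (ρ : Ranking rest (suc c)) → Ranking.label ρ x ≢ Ranking.label ρ y →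
          Ranking ((x , y , t) ∷ rest) c
  merge {c} ρ x≁y = record
    { label            = merged ∘ label
    ; label-surjective = surjective
    ; label-respects   = λ { (here refl) → identify-identifies (label x) (label y) x≁y
                           ; (there e)   → cong merged (label-respects e) }
    ; exceptions       = exceptions
    ; rank             = raised
    ; rank-increases   = increases
    ; size             = subst (∣ exceptions ∣ + n ≤_) (+-suc (length rest) c) size
    }
    where
    open Ranking ρ
    open Raise label rank x (label y)

    merged : Fin (suc c) → Fin c
    merged = identify (label x) (label y) x≁y

    surjective : ∀ d → ∃ λ u → merged (label u) ≡ d
    surjective d with identify-surjective (label x) (label y) x≁y d
    ... | k , k↦d with label-surjective k
    ...   | u , u↦k = u , trans (cong merged u↦k) k↦d

    increases : ∀ {u v t₀ t₁} → JourneyIn ((x , y , t) ∷ rest) u v t₀ t₁ →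
                u ∉ₛ exceptions → v ∉ₛ exceptions → raised u < raised v
    increases j u∉ v∉ with journey-split later j
    ... | inj₁ j′                         = raised-mono (label-respects-journeys j′) (rank-increases j′ u∉ v∉)
    ... | inj₂ (refl , inj₁ refl)         = subst (_< raised y) (sym (raised-outside x≁y)) (raised-above refl)
    ... | inj₂ (refl , inj₂ (_ , _ , j′)) =
      subst (_< raised _) (sym (raised-outside x≁y)) (raised-above (sym (label-respects-journeys j′)))

ranking-∷ : ∀ {n} {x y : Fin n} {t rest} → All (λ a → t ≤ time a) rest →
            ∃ (Ranking rest) → ∃ (Ranking ((x , y , t) ∷ rest))
ranking-∷ {x = x} later (zero , ρ) = ⊥-elim (¬Fin0 (Ranking.label ρ x))
ranking-∷ {x = x} {y} later (suc c , ρ) with Ranking.label ρ x ≟ᶠ Ranking.label ρ y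
... | yes x~y = suc c , absorb later ρ x~y
... | no  x≁y = c , merge later ρ x≁y

module SortByTime {n} = Data.List.Sort (On.decTotalOrder ≤-decTotalOrder (time {n}))
open SortByTime using (sort; sort-↭; sort-↗)

ranking-sorted : ∀ {n} {L : List (TArc n)} → AllPairs (λ a b → time a ≤ time b) L → ∃ (Ranking L)
ranking-sorted []               = _ , ranking-[]
ranking-sorted (later ∷ sorted) = ranking-∷ later (ranking-sorted sorted)

ranking : ∀ {n} (L : List (TArc n)) → ∃ (Ranking (sort L))
ranking L = ranking-sorted (Linked⇒AllPairs ≤-trans (sort-↗ L))

coarser-surjection⇒≤ : ∀ {n c d} {label : Fin n → Fin c} {comp : Fin n → Fin d} →
                        (∀ k → ∃ λ u → label u ≡ k) →
                        (∀ {u v} → comp u ≡ comp v → label u ≡ label v) → c ≤ d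
coarser-surjection⇒≤ {comp = comp} surjective coarser =
  injective⇒≤ {f = comp ∘ proj₁ ∘ surjective}
    (λ {k} {k′} same → trans (sym (proj₂ (surjective k))) (trans (coarser same) (proj₂ (surjective k′))))

lower-bound : ∀ {n cc f} {A : Digraph n} → NumComponents A cc → MinDFVSSize A f →
              (𝒢 : TemporalDigraph n) → Realizes 𝒢 A → n + f ≤ length (arcs 𝒢) + cc
lower-bound {n} {cc} {f} {A} (comp , _ , comp-connected) (_ , minimal) 𝒢 realizes = begin
  n + f                       ≤⟨ +-monoʳ-≤ n (minimal exceptions exceptions-DFVS) ⟩
  n + ∣ exceptions ∣          ≡⟨ +-comm n _ ⟩
  ∣ exceptions ∣ + n          ≤⟨ size ⟩
  length (sort (arcs 𝒢)) + c  ≡⟨ cong (_+ c) (↭-length (sort-↭ (arcs 𝒢))) ⟩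
  length (arcs 𝒢) + c         ≤⟨ +-monoʳ-≤ (length (arcs 𝒢)) classes≤cc ⟩
  length (arcs 𝒢) + cc        ∎
  where
  open ≤-Reasoning
  c = proj₁ (ranking (arcs 𝒢))
  open Ranking (proj₂ (ranking (arcs 𝒢)))

  journey : ∀ {u v} → T (A u v) → ∃₂ (JourneyIn (sort (arcs 𝒢)) u v)
  journey {u} {v} u→v with realizes u v u→v
  ... | t , j with JourneyAt⇒JourneyIn j
  ...   | t′ , j′ = t , t′ , JourneyIn-mono (∈-resp-↭ (↭-sym (sort-↭ (arcs 𝒢)))) j′

  exceptions-DFVS : IsDFVS A exceptions
  exceptions-DFVS = increasing-rank⇒DFVS A exceptions rank (rank-increases ∘ proj₂ ∘ proj₂ ∘ journey)

  classes≤cc : c ≤ cc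
  classes≤cc = coarser-surjection⇒≤ label-surjective
    (WeaklyConnected⇒≡ label (label-respects-journeys ∘ proj₂ ∘ proj₂ ∘ journey)
     ∘ Equivalence.to (comp-connected _ _))

links : ∀ {n} → ℕ → List (Fin n) → List (TArc n)
links t (x ∷ y ∷ ys) = (x , y , t) ∷ links (suc t) (y ∷ ys)
links t _            = []

module _ {n : ℕ} where

  links-time : ∀ {t} {xs : List (Fin n)} {a} → a ∈ links t xs → t ≤ time a × time a < t + length xs
  links-time {t} {x ∷ y ∷ ys}     (here refl) = ≤-refl , m<m+n t (s≤s z≤n)
  links-time {t} {x ∷ y ∷ ys} {a} (there a∈) with links-time {suc t} {y ∷ ys} a∈
  ... | t<time , time< = <⇒≤ t<time , subst (time a <_) (sym (+-suc t _)) time<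

  links-loopless : ∀ {t} {xs : List (Fin n)} {u v t′} → Unique xs → (u , v , t′) ∈ links t xs → u ≢ v
  links-loopless {xs = x ∷ y ∷ ys} ((x≢y ∷ _) ∷ _) (here refl) = x≢y
  links-loopless {xs = x ∷ y ∷ ys} (_ ∷ !ys)       (there e)   = links-loopless !ys e

  links-journey : ∀ {t} {xs : List (Fin n)} {u v} → Before xs u v → ∃₂ (JourneyIn (links t xs) u v)
  links-journey {t} {u ∷ y ∷ ys} (here (here refl)) = t , t , arc (here refl)
  links-journey {t} {u ∷ y ∷ ys} (here (there v∈)) with links-journey {suc t} (here v∈)
  ... | _ , t₁ , j = t , t₁ , here refl ∷⟨ proj₁ (links-time (proj₂ (departure-∈ j))) ⟩ JourneyIn-mono there j
  links-journey {t} {x ∷ y ∷ ys} (there b) with links-journey {suc t} b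
  ... | t₀ , t₁ , j = t₀ , t₁ , JourneyIn-mono there j
  links-journey {xs = _ ∷ []} (there ())

  length-links : ∀ t x (xs : List (Fin n)) → length (links t (x ∷ xs)) ≡ length xs
  length-links t x []       = refl
  length-links t x (y ∷ ys) = cong suc (length-links (suc t) y ys)

  length-concat-links : ∀ t {xss : List (List (Fin n))} → All (λ xs → ∃ (_∈ xs)) xss →
                        length (concatMap (links t) xss) + length xss ≤ length (concat xss)
  length-concat-links t []                               = z≤n
  length-concat-links t {[] ∷ _}         ((_ , ()) ∷ _)
  length-concat-links t {(y ∷ ys) ∷ xss} (_ ∷ nonempty) = begin
    length (links t (y ∷ ys) ++ L) + suc (length xss)
      ≡⟨ cong (_+ suc (length xss)) (trans (length-++ (links t (y ∷ ys))) (cong (_+ length L) (length-links t y ys))) ⟩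
    length ys + length L + suc (length xss)
      ≡⟨ trans (+-suc _ (length xss)) (cong suc (+-assoc (length ys) (length L) (length xss))) ⟩
    suc (length ys + (length L + length xss))
      ≤⟨ s≤s (+-monoʳ-≤ (length ys) (length-concat-links t nonempty)) ⟩
    suc (length ys + length (concat xss))
      ≡⟨ cong suc (sym (length-++ ys)) ⟩
    length ((y ∷ ys) ++ concat xss)
      ∎
    where
    open ≤-Reasoning
    L = concatMap (links t) xss

module Construction {n cc} (A : Digraph n) (comp : Fin n → Fin cc)
                    (comp-respects : ∀ {u v} → T (A u v) → comp u ≡ comp v)
                    (S : Subset n) (meets : ∀ c → ∃ λ w → w ∉ₛ S × comp w ≡ c)
                    (topological : TopologicalOrder A (elements (∁ S))) where

  open TopologicalOrder topological

  chain : Fin cc → List (Fin n)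
  chain c = filter (λ v → comp v ≟ᶠ c) order

  chains : List (List (Fin n))
  chains = map chain (allFin cc)

  -- The default vertex is never used: it lies on the chain, which is therefore nonempty.
  first final : Fin cc → Fin n
  first c = fromMaybe (proj₁ (meets c)) (head (chain c))
  final c = fromMaybe (proj₁ (meets c)) (List.last (chain c))

  -- Later than every link, as a chain has at most n vertices.
  late : ℕ
  late = suc (suc n)

  enter leave : Fin n → TArc n
  enter s = s , first (comp s) , 1
  leave s = final (comp s) , s , late

  linkArcs : List (TArc n)
  linkArcs = concatMap (links 2) chains

  arcList : List (TArc n)
  arcList = map enter (elements S) ++ map leave (elements S) ++ linkArcs

  ∈-chain⁺ : ∀ {v c} → v ∉ₛ S → comp v ≡ c → v ∈ chain c
  ∈-chain⁺ v∉S v∈c = ∈-filter⁺ _ (Equivalence.from members (∈-elements-∁⁺ v∉S)) v∈c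

  ∈-chain⁻ : ∀ {v c} → v ∈ chain c → v ∉ₛ S × comp v ≡ c
  ∈-chain⁻ v∈ with ∈-filter⁻ _ {xs = order} v∈
  ... | v∈order , v∈c = ∈-elements-∁⁻ (Equivalence.to members v∈order) , v∈c

  chain-unique : ∀ c → Unique (chain c)
  chain-unique c = Unique.filter⁺ _ unique

  all-chains : ∀ {P : List (Fin n) → Set} → (∀ c → P (chain c)) → All P chains
  all-chains P-chain = All.map⁺ (All.tabulate {xs = allFin cc} (λ {c} _ → P-chain c))

  first-∈ : ∀ c → first c ∈ chain c
  first-∈ c = head-∈ _ (∈-chain⁺ (proj₁ (proj₂ (meets c))) (proj₂ (proj₂ (meets c))))

  final-∈ : ∀ c → final c ∈ chain c
  final-∈ c = last-∈ _ (∈-chain⁺ (proj₁ (proj₂ (meets c))) (proj₂ (proj₂ (meets c))))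

  enter-∈ : ∀ {s c} → s ∈ₛ S → comp s ≡ c → (s , first c , 1) ∈ arcList
  enter-∈ s∈S refl = ∈-++⁺ˡ (∈-map⁺ enter (∈-elements⁺ s∈S))

  leave-∈ : ∀ {s c} → s ∈ₛ S → comp s ≡ c → (final c , s , late) ∈ arcList
  leave-∈ s∈S refl = ∈-++⁺ʳ (map enter (elements S)) (∈-++⁺ˡ (∈-map⁺ leave (∈-elements⁺ s∈S)))

  links-⊆ : ∀ c {a} → a ∈ links 2 (chain c) → a ∈ arcList
  links-⊆ c a∈ = ∈-++⁺ʳ (map enter (elements S)) (∈-++⁺ʳ (map leave (elements S))
                   (∈-concat⁺′ a∈ (∈-map⁺ (links 2) (∈-map⁺ chain (∈-allFin c)))))

  chain-journey : ∀ {c u v} → Before (chain c) u v →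
                  ∃₂ λ t₀ t₁ → 2 ≤ t₀ × t₁ < late × JourneyIn arcList u v t₀ t₁
  chain-journey {c} b with links-journey {t = 2} b
  ... | t₀ , t₁ , j =
    t₀ , t₁ , proj₁ (links-time (proj₂ (departure-∈ j))) ,
    <-≤-trans (proj₂ (links-time (proj₂ (arrival-∈ j)))) (+-monoʳ-≤ 2 (length≤n (chain-unique c))) ,
    JourneyIn-mono (links-⊆ c) j

  from-S : ∀ {s c w} → s ∈ₛ S → comp s ≡ c → w ∈ chain c →
           ∃ λ t₁ → t₁ < late × JourneyIn arcList s w 1 t₁
  from-S {s} s∈S s∈c w∈ with head-Before _ w∈
  ... | inj₁ first≡w =
    1 , s≤s (s≤s z≤n) , subst (λ w → JourneyIn arcList s w 1 1) first≡w (arc (enter-∈ s∈S s∈c))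
  ... | inj₂ b with chain-journey b
  ...   | _ , t₁ , 2≤t₀ , t₁<late , j = t₁ , t₁<late , arc (enter-∈ s∈S s∈c) ++⟨ 2≤t₀ ⟩ j

  to-S : ∀ {s c w} → s ∈ₛ S → comp s ≡ c → w ∈ chain c → ∃ λ t₀ → JourneyIn arcList w s t₀ late
  to-S {s} s∈S s∈c w∈ with last-Before _ w∈
  ... | inj₁ w≡final =
    late , subst (λ w → JourneyIn arcList w s late late) (sym w≡final) (arc (leave-∈ s∈S s∈c))
  ... | inj₂ b with chain-journey b
  ...   | t₀ , _ , _ , t₁<late , j = t₀ , j ++⟨ t₁<late ⟩ arc (leave-∈ s∈S s∈c)

  realizes : ∀ {u v} → T (A u v) → ∃₂ (JourneyIn arcList u v)
  realizes {u} {v} u→v with u ∈? S | v ∈? S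
  ... | no u∉S | no v∉S
    with chain-journey (Before-filter _ (forward u→v (∈-elements-∁⁺ u∉S) (∈-elements-∁⁺ v∉S))
                                      refl (sym (comp-respects u→v)))
  ...   | t₀ , t₁ , _ , _ , j = t₀ , t₁ , j
  realizes u→v | yes u∈S | no v∉S with from-S u∈S refl (∈-chain⁺ v∉S (sym (comp-respects u→v)))
  ...   | t₁ , _ , j = 1 , t₁ , j
  realizes u→v | no u∉S | yes v∈S with to-S v∈S refl (∈-chain⁺ u∉S (comp-respects u→v))
  ...   | t₀ , j = t₀ , late , j
  realizes {u} u→v | yes u∈S | yes v∈S with from-S u∈S refl (final-∈ (comp u))
  ...   | t₁ , t₁<late , j = 1 , late , j ++⟨ t₁<late ⟩ arc (leave-∈ v∈S (sym (comp-respects u→v)))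

  arcList-valid : All ValidTArc arcList
  arcList-valid = All.++⁺ (All.map⁺ (All.tabulate enter-valid))
                    (All.++⁺ (All.map⁺ (All.tabulate leave-valid))
                      (All.concat⁺ (All.map⁺ {f = links 2} (all-chains links-valid))))
    where
    enter-valid : ∀ {s} → s ∈ elements S → ValidTArc (enter s)
    enter-valid {s} s∈ =
      (λ s≡first → proj₁ (∈-chain⁻ (first-∈ (comp s))) (subst (_∈ₛ S) s≡first (∈-elements⁻ s∈))) , s≤s z≤n

    leave-valid : ∀ {s} → s ∈ elements S → ValidTArc (leave s)
    leave-valid {s} s∈ =
      (λ final≡s → proj₁ (∈-chain⁻ (final-∈ (comp s))) (subst (_∈ₛ S) (sym final≡s) (∈-elements⁻ s∈))) , s≤s z≤n

    links-valid : ∀ c → All ValidTArc (links 2 (chain c))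
    links-valid c = All.tabulate (λ a∈ → links-loopless (chain-unique c) a∈ , <⇒≤ (proj₁ (links-time a∈)))

  length-arcList : length arcList ≡ length (elements S) + (length (elements S) + length linkArcs)
  length-arcList = trans (length-++ (map enter (elements S)))
    (cong₂ _+_ (length-map enter (elements S))
      (trans (length-++ (map leave (elements S))) (cong (_+ length linkArcs) (length-map leave (elements S)))))

  length-linkArcs : length linkArcs + cc ≤ length (concat chains)
  length-linkArcs = subst (λ k → length linkArcs + k ≤ length (concat chains))
    (trans (length-map chain (allFin cc)) (length-tabulate (λ c → c)))
    (length-concat-links 2 (all-chains (λ c → first c , first-∈ c)))

  length-S+chains : length (elements S) + length (concat chains) ≤ n
  length-S+chains = subst (_≤ n) (length-++ (elements S)) (length≤n (Unique.++⁺ elements-unique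
    (Unique.concat⁺ (all-chains chain-unique) (AllPairs.map⁺ (AllPairs.map chains-disjoint (Unique.allFin⁺ cc))))
    (λ (v∈S , v∈chains) → All.lookup chains-outside v∈chains (∈-elements⁻ v∈S))))
    where
    chains-disjoint : ∀ {i j} → i ≢ j → Disjoint (chain i) (chain j)
    chains-disjoint i≢j (v∈i , v∈j) = i≢j (trans (sym (proj₂ (∈-chain⁻ v∈i))) (proj₂ (∈-chain⁻ v∈j)))

    chains-outside : All (_∉ₛ S) (concat chains)
    chains-outside = All.concat⁺ (all-chains (λ _ → All.tabulate (proj₁ ∘ ∈-chain⁻)))

  arcList-size : length arcList + cc ≤ n + ∣ S ∣
  arcList-size = begin
    length arcList + cc               ≡⟨ cong (_+ cc) length-arcList ⟩
    s + (s + L) + cc                  ≡⟨ +-assoc s (s + L) cc ⟩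
    s + (s + L + cc)                  ≡⟨ cong (s +_) (+-assoc s L cc) ⟩
    s + (s + (L + cc))                ≤⟨ +-monoʳ-≤ s (+-monoʳ-≤ s length-linkArcs) ⟩
    s + (s + length (concat chains))  ≤⟨ +-mono-≤ (length≤∣ S ∣ elements-unique (All.tabulate ∈-elements⁻))
                                                  length-S+chains ⟩
    ∣ S ∣ + n                         ≡⟨ +-comm ∣ S ∣ n ⟩
    n + ∣ S ∣                         ∎
    where
    open ≤-Reasoning
    s = length (elements S)
    L = length linkArcs

  _≟ₐ_ : (a b : TArc n) → Dec (a ≡ b)
  _≟ₐ_ = ≡-dec _≟ᶠ_ (≡-dec _≟ᶠ_ _≟ⁿ_)

  -- arcList has no repeated arcs, but deduplicating is cheaper than proving it.
  𝒢 : TemporalDigraph n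
  𝒢 = record
    { arcs     = deduplicate _≟ₐ_ arcList
    ; distinct = deduplicate-! _≟ₐ_ arcList
    ; valid    = All.deduplicate⁺ _≟ₐ_ arcList-valid
    }

  𝒢-size : length (arcs 𝒢) + cc ≤ n + ∣ S ∣
  𝒢-size = ≤-trans (+-monoˡ-≤ cc (length-deduplicate _≟ₐ_ arcList)) arcList-size

  𝒢-realizes : Realizes 𝒢 A
  𝒢-realizes u v u→v with realizes u→v
  ... | t₀ , _ , j = t₀ , JourneyIn⇒JourneyAt (JourneyIn-mono (∈-deduplicate⁺ _≟ₐ_) j)

upper-bound : ∀ {n cc f} {A : Digraph n} → Loopless A → NumComponents A cc → MinDFVSSize A f →
              ∃ λ 𝒢 → length (arcs 𝒢) + cc ≤ n + f × Realizes 𝒢 A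
upper-bound {n} {cc} {f} {A} loopless (comp , comp-surjective , comp-connected) ((S , dfvs , ∣S∣≡f) , minimal) =
  𝒢 , subst (length (arcs 𝒢) + cc ≤_) (cong (n +_) ∣S∣≡f) 𝒢-size , 𝒢-realizes
  where
  comp-respects : ∀ {u v} → T (A u v) → comp u ≡ comp v
  comp-respects u→v = Equivalence.from (comp-connected _ _) (inj₁ u→v ◅ ε)

  minimum : IsMinimumDFVS A S
  minimum = dfvs , λ S′ dfvs′ → subst (_≤ ∣ S′ ∣) (sym ∣S∣≡f) (minimal S′ dfvs′)

  meets : ∀ c → ∃ λ w → w ∉ₛ S × comp w ≡ c
  meets c with comp-surjective c
  ... | u , u∈c with every-class-meets-complement comp comp-respects loopless minimum u
  ...   | w , w∉S , w~u = w , w∉S , trans w~u u∈c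

  open Construction A comp comp-respects S meets
         (topological-sort A n (elements (∁ S)) (length≤n elements-unique) (complement-acyclic dfvs))

theorem3p5 : (n : ℕ) (A : Digraph n) → Loopless A →
    (cc : ℕ) → NumComponents A cc →
    (f : ℕ) → MinDFVSSize A f →
    (k : ℕ) →
    (∃ λ (𝒢 : TemporalDigraph n) →
        length (arcs 𝒢) ≤ k ×
        ((u v : Fin n) → T (A u v) → Journey 𝒢 u v))
    ⇔ (n + f ∸ cc ≤ k)
theorem3p5 n A loopless cc components f minimum k = mk⇔ necessary sufficient
  where
  necessary : (∃ λ 𝒢 → length (arcs 𝒢) ≤ k × Realizes 𝒢 A) → n + f ∸ cc ≤ k
  necessary (𝒢 , |𝒢|≤k , realizes) = m≤n+o⇒m∸n≤o (n + f) cc (begin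
    n + f                ≤⟨ lower-bound components minimum 𝒢 realizes ⟩
    length (arcs 𝒢) + cc ≤⟨ +-monoˡ-≤ cc |𝒢|≤k ⟩
    k + cc               ≡⟨ +-comm k cc ⟩
    cc + k               ∎)
    where open ≤-Reasoning

  sufficient : n + f ∸ cc ≤ k → ∃ λ 𝒢 → length (arcs 𝒢) ≤ k × Realizes 𝒢 A
  sufficient bound with upper-bound loopless components minimum
  ... | 𝒢 , size , realizes = 𝒢 , ≤-trans (m+n≤o⇒m≤o∸n (length (arcs 𝒢)) size) bound , realizes
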